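{- Let $M_\mu=\langle W,\mu,\mathcal{F},V\rangle$ be a gtf-model and let $\varphi$ be a formula. Then: (1) If $w\Vdash_\mu\varphi$ for every $w\in\bigcup\mu$, $v\in W\setminus\bigcup\mu$ and $\emptyset\notin\mathcal{F}_v$, then $v\Vdash_\mu\Diamond\varphi$. (2) If $w\Vdash_\mu\varphi$ for every $w\in\bigcup\mu$, $v\in W\setminus\bigcup\mu$ and $\mathcal{F}_v\neq\emptyset$, then $v\Vdash_\mu\Box\varphi$. (3) If $\mathcal{F}_w\neq\emptyset$ for every $w\in W$ and $\varphi$ holds at every world of $\bigcup\mu$, then $\Box\varphi$ holds at every world of $W$; consequently, under the assumption that $\mathcal{F}_w\neq\emptyset$ for all $w$, if $\varphi$ holds at every world of $W$ then so does $\Box\varphi$. (4) If $v\in W\setminus\bigcup\mu$, $w\in\bigcup\mu$ and $\mathcal{F}_v=\mathcal{F}_w$, then for every formula $\psi\in MOD$, $v\Vdash_\mu\psi$ iff $w\Vdash_\mu\psi$, where $MOD$ is the smallest set of formulas containing $\Box\gamma$ for every formula $\gamma$ and closed under $\lor,\land,\to$.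
   Context: Formulas are built from a countable set $PV$ of propositional variables using $\bot,\lnot,\land,\lor,\to,\Box$; $\Diamond\varphi$ abbreviates $\lnot\Box\lnot\varphi$. A generalized topology on a nonempty set $W$ is a family $\mu\subseteq P(W)$ with $\emptyset\in\mu$ and closed under unions of arbitrary nonempty subfamilies; $\bigcup\mu$ is the union of all members of $\mu$. A gtf-model is $\langle W,\mu,\mathcal{F},V\rangle$ where $\mu$ is a generalized topology on $W$, $V:PV\to P(W)$, and $\mathcal{F}:W\to P(P(\bigcup\mu))$ (write $\mathcal{F}_w$) satisfies: if $w\in\bigcup\mu$ then for every $X$, $X\in\mathcal{F}_w$ iff ($X\in\mu$ and $w\in X$); if $w\in W\setminus\bigcup\mu$ then every $X\in\mathcal{F}_w$ belongs to $\mu$. Satisfaction $\Vdash_\mu$: $w\Vdash_\mu q$ iff $w\in V(q)$; Boolean clauses classical; $w\Vdash_\mu\Box\varphi$ iff there is $O\in\mathcal{F}_w$ with $v\Vdash_\mu\varphi$ for all $v\in O$. -}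

module Defs where

open import Level using (Level; Lift; lift) renaming (zero to lzero; suc to lsuc)
open import Data.Nat using (ℕ)
open import Data.Empty using (⊥)
open import Data.Product using (Σ; _×_; _,_; ∃)
open import Data.Sum using (_⊎_)
open import Relation.Nullary using (¬_)

PV : Set
PV = ℕ

infixr 6 _∧'_
infixr 5 _∨'_
infixr 4 _⇒_

data Formula : Set where
  var  : PV → Formula
  ⊥'   : Formula
  ¬'_  : Formula → Formula
  _∧'_ : Formula → Formula → Formula
  _∨'_ : Formula → Formula → Formula
  _⇒_  : Formula → Formula → Formula
  □_   : Formula → Formula

◇_ : Formula → Formula
◇ φ = ¬' (□ (¬' φ))

Subset : Set → Set₁
Subset W = W → Set

Family : Set → Set₁
Family W = Subset W → Set

_≐_ : {W : Set} → Subset W → Subset W → Set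
_≐_ {W} X Y = (w : W) → (X w → Y w) × (Y w → X w)

IsEmpty : {W : Set} → Subset W → Set
IsEmpty {W} X = (w : W) → ¬ X w

⋃ : {W : Set} → Family W → W → Set₁
⋃ {W} 𝒜 w = Σ (Subset W) λ X → 𝒜 X × X w

-- Generalized topology: ∅ ∈ μ and μ is closed under unions of
-- arbitrary nonempty subfamilies (membership up to extensional equality
-- of subsets, since subsets are predicates).
record IsGenTop {W : Set} (μ : Family W) : Set₁ where
  field
    empty∈ : Σ (Subset W) λ E → μ E × IsEmpty E
    union∈ : (𝒜 : Family W) → ((X : Subset W) → 𝒜 X → μ X) →
             (Σ (Subset W) 𝒜) →
             Σ (Subset W) λ U → μ U ×
               ((w : W) → (U w → ⋃ 𝒜 w) × (⋃ 𝒜 w → U w))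

record GTFModel : Set₂ where
  field
    W        : Set
    inhabited : W
    μ        : Family W
    isGenTop : IsGenTop μ
    F        : W → Family W
    F⊆       : (w : W) (X : Subset W) → F w X → (v : W) → X v → ⋃ μ v
    F-in     : (w : W) → ⋃ μ w → (X : Subset W) →
               (F w X → μ X × X w) × (μ X × X w → F w X)
    F-out    : (w : W) → ¬ ⋃ μ w → (X : Subset W) → F w X → μ X
    V        : PV → Subset W

module _ (M : GTFModel) where
  open GTFModel M

  _⊩_ : W → Formula → Set₁
  w ⊩ var q    = Lift _ (V q w)
  w ⊩ ⊥'       = Lift _ ⊥
  w ⊩ (¬' φ)   = ¬ (w ⊩ φ)
  w ⊩ (φ ∧' ψ) = (w ⊩ φ) × (w ⊩ ψ)
  w ⊩ (φ ∨' ψ) = (w ⊩ φ) ⊎ (w ⊩ ψ)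
  w ⊩ (φ ⇒ ψ)  = (w ⊩ φ) → (w ⊩ ψ)
  w ⊩ (□ φ)    = Σ (Subset W) λ O → F w O × ((v : W) → O v → v ⊩ φ)

data MOD : Formula → Set where
  mod-□ : (γ : Formula) → MOD (□ γ)
  mod-∨ : {φ ψ : Formula} → MOD φ → MOD ψ → MOD (φ ∨' ψ)
  mod-∧ : {φ ψ : Formula} → MOD φ → MOD ψ → MOD (φ ∧' ψ)
  mod-⇒ : {φ ψ : Formula} → MOD φ → MOD ψ → MOD (φ ⇒ ψ)

-- Every neighbourhood in 𝓕_v is contained in ⋃μ, so whatever holds throughout ⋃μ
-- holds throughout any neighbourhood of any world: □φ then only needs some neighbourhood,
-- and ◇φ fails only through an empty one. Formulas of MOD are truth-functional
-- combinations of boxes, and the truth of □γ at a world depends on its neighbourhood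
-- family alone, so worlds with the same family agree on MOD.
module Submission where

open import Defs
open import Data.Product using (Σ; _×_; _,_; proj₁; proj₂)
open import Data.Sum using (inj₁; inj₂)
open import Function using (_∘_)
open import Relation.Nullary using (¬_)
open GTFModel

module _ (M : GTFModel) where

  private
    _⊨_ = _⊩_ M

  ValidOn⋃μ : Formula → Set₁
  ValidOn⋃μ φ = (w : W M) → ⋃ (μ M) w → w ⊨ φ

  Valid : Formula → Set₁
  Valid φ = (w : W M) → w ⊨ φ

  Valid⇒ValidOn⋃μ : ∀ {φ} → Valid φ → ValidOn⋃μ φ
  Valid⇒ValidOn⋃μ h w _ = h w

  ValidOn⋃μ⇒⊩-on-F : ∀ {φ} → ValidOn⋃μ φ →
    (v : W M) (O : Subset (W M)) → F M v O → (u : W M) → O u → u ⊨ φ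
  ValidOn⋃μ⇒⊩-on-F h v O O∈F u u∈O = h u (F⊆ M v O O∈F u u∈O)

  □-intro : ∀ {φ} → ValidOn⋃μ φ → (v : W M) → Σ (Subset (W M)) (F M v) → v ⊨ (□ φ)
  □-intro h v (O , O∈F) = O , O∈F , ValidOn⋃μ⇒⊩-on-F h v O O∈F

  ◇-intro : ∀ {φ} → ValidOn⋃μ φ → (v : W M) →
    ¬ (Σ (Subset (W M)) λ X → F M v X × IsEmpty X) → v ⊨ (◇ φ)
  ◇-intro h v ∅∉F (O , O∈F , ¬φ-on-O) =
    ∅∉F (O , O∈F , λ u u∈O → ¬φ-on-O u u∈O (ValidOn⋃μ⇒⊩-on-F h v O O∈F u u∈O))

  MOD-⊩-resp-F : (v w : W M) →
    ((X : Subset (W M)) → (F M v X → F M w X) × (F M w X → F M v X)) →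
    {ψ : Formula} → MOD ψ → (v ⊨ ψ → w ⊨ ψ) × (w ⊨ ψ → v ⊨ ψ)
  MOD-⊩-resp-F v w F≐ (mod-□ γ) =
    (λ (O , O∈F , k) → O , proj₁ (F≐ O) O∈F , k) ,
    (λ (O , O∈F , k) → O , proj₂ (F≐ O) O∈F , k)
  MOD-⊩-resp-F v w F≐ (mod-∨ a b) with MOD-⊩-resp-F v w F≐ a | MOD-⊩-resp-F v w F≐ b
  ... | a→ , a← | b→ , b← =
    (λ { (inj₁ x) → inj₁ (a→ x) ; (inj₂ y) → inj₂ (b→ y) }) ,
    (λ { (inj₁ x) → inj₁ (a← x) ; (inj₂ y) → inj₂ (b← y) })
  MOD-⊩-resp-F v w F≐ (mod-∧ a b) with MOD-⊩-resp-F v w F≐ a | MOD-⊩-resp-F v w F≐ b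
  ... | a→ , a← | b→ , b← = (λ (x , y) → a→ x , b→ y) , (λ (x , y) → a← x , b← y)
  MOD-⊩-resp-F v w F≐ (mod-⇒ a b) with MOD-⊩-resp-F v w F≐ a | MOD-⊩-resp-F v w F≐ b
  ... | a→ , a← | b→ , b← = (λ f → b→ ∘ f ∘ a←) , (λ f → b← ∘ f ∘ a→)

mainTheorem6 : (M : GTFModel) (φ : Formula) →
    -- (1)
    (((w : W M) → ⋃ (μ M) w → _⊩_ M w φ) →
      (v : W M) → ¬ ⋃ (μ M) v →
      ¬ (Σ (Subset (W M)) λ X → F M v X × IsEmpty X) →
      _⊩_ M v (◇ φ))
    ×
    -- (2)
    (((w : W M) → ⋃ (μ M) w → _⊩_ M w φ) →
      (v : W M) → ¬ ⋃ (μ M) v →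
      Σ (Subset (W M)) (F M v) →
      _⊩_ M v (□ φ))
    ×
    -- (3)
    ((((w : W M) → Σ (Subset (W M)) (F M w)) →
        ((w : W M) → ⋃ (μ M) w → _⊩_ M w φ) →
        (w : W M) → _⊩_ M w (□ φ))
      ×
      (((w : W M) → Σ (Subset (W M)) (F M w)) →
        ((w : W M) → _⊩_ M w φ) →
        (w : W M) → _⊩_ M w (□ φ)))
    ×
    -- (4)
    ((v w : W M) → ¬ ⋃ (μ M) v → ⋃ (μ M) w →
      ((X : Subset (W M)) → (F M v X → F M w X) × (F M w X → F M v X)) →
      (ψ : Formula) → MOD ψ →
      (_⊩_ M v ψ → _⊩_ M w ψ) × (_⊩_ M w ψ → _⊩_ M v ψ))
mainTheorem6 M φ =
  (λ h v _ → ◇-intro M h v) ,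
  (λ h v _ → □-intro M h v) ,
  ((λ F≠∅ h w → □-intro M h w (F≠∅ w)) ,
   (λ F≠∅ h w → □-intro M (Valid⇒ValidOn⋃μ M h) w (F≠∅ w))) ,
  (λ v w _ _ F≐ _ → MOD-⊩-resp-F M v w F≐)
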